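{- Let $t$ be a $\lambda$-term in de Bruijn notation and $\ell$ an $\mathcal{L}$-type such that $t:\ell$ is derivable in the $\mathcal{L}$-type system described in the context. Then $\ell$ is sorted in increasing order.
   Context: Terms with implicit names (de Bruijn notation) are given by $t ::= \underline{n} \mid \lambda t \mid t\,t$ with $n\in\mathbb{N}$. $\mathcal{L}$-types are finite lists of natural numbers: $\ell ::= [] \mid i :: \ell$. The partial binary operation merge $\ddagger$ on lists is defined by: $[]\ddagger \ell=\ell$; $(i::\ell)\ddagger []=i::\ell$; $(i_1::\ell_1)\ddagger(i_2::\ell_2)= i_1::(\ell_1\ddagger(i_2::\ell_2))$ if $i_1<i_2$, and $=i_2::((i_1::\ell_1)\ddagger \ell_2)$ if $i_1>i_2$; it is undefined when this recursion reaches two lists with equal heads. The partial unary operation decrement $\downarrow$ is defined only on lists all of whose elements are strictly positive: $\downarrow[]=[]$, $\downarrow((i+1)::\ell)=i::\downarrow\ell$. The typing judgement $t:\ell$ is generated by the rules: (ind) $\underline{i}:[i]$; (abs) if $t:0::\ell$ then $\lambda t:\downarrow\ell$ (applicable only when $\downarrow\ell$ is defined); (app) if $t_1:\ell_1$ and $t_2:\ell_2$ then $t_1\,t_2:\ell_1\ddagger\ell_2$ (applicable only when $\ell_1\ddagger\ell_2$ is defined). -}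

module Defs where

open import Data.Nat using (ℕ; zero; suc; _<_)
open import Data.Nat.Properties using (<-cmp)
open import Relation.Binary.Definitions using (Tri; tri<; tri≈; tri>)
open import Data.List using (List; []; _∷_)
open import Data.Maybe using (Maybe; just; nothing; map)
open import Relation.Binary.PropositionalEquality using (_≡_)

data Term : Set where
  var : ℕ → Term
  lam : Term → Term
  app : Term → Term → Term

-- merge ‡ : partial, nothing = undefined
-- (defined by the paper's recursion; the auxiliary mergeAux fixes the
--  head i₁ ∷ ℓ₁ of the first list, with rec = (ℓ₁ ‡_), to ensure termination)
mutual
  _‡_ : List ℕ → List ℕ → Maybe (List ℕ)
  [] ‡ ℓ = just ℓ
  (i₁ ∷ ℓ₁) ‡ ℓ₂ = mergeAux i₁ ℓ₁ ℓ₂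

  mergeAux : ℕ → List ℕ → List ℕ → Maybe (List ℕ)
  mergeAux i₁ ℓ₁ [] = just (i₁ ∷ ℓ₁)
  mergeAux i₁ ℓ₁ (i₂ ∷ ℓ₂) = step (<-cmp i₁ i₂)
    where
    step : Tri (i₁ < i₂) (i₁ ≡ i₂) (i₂ < i₁) → Maybe (List ℕ)
    step (tri< _ _ _) = map (i₁ ∷_) (ℓ₁ ‡ (i₂ ∷ ℓ₂))
    step (tri≈ _ _ _) = nothing
    step (tri> _ _ _) = map (i₂ ∷_) (mergeAux i₁ ℓ₁ ℓ₂)

↓ : List ℕ → Maybe (List ℕ)
↓ [] = just []
↓ (zero ∷ ℓ) = nothing
↓ (suc i ∷ ℓ) = map (i ∷_) (↓ ℓ)

infix 4 _∶_
data _∶_ : Term → List ℕ → Set where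
  ind : (i : ℕ) → var i ∶ (i ∷ [])
  abs : {t : Term} {ℓ ℓ' : List ℕ} → t ∶ (0 ∷ ℓ) → ↓ ℓ ≡ just ℓ' → lam t ∶ ℓ'
  ap  : {t₁ t₂ : Term} {ℓ₁ ℓ₂ ℓ : List ℕ} → t₁ ∶ ℓ₁ → t₂ ∶ ℓ₂ → (ℓ₁ ‡ ℓ₂) ≡ just ℓ → app t₁ t₂ ∶ ℓ

-- Both ways of building a type preserve sortedness. A successful merge is a
-- genuine merge of two sorted lists (the undefined case being a clash of
-- heads), hence sorted; a successful decrement subtracts one from every
-- element, which preserves strict order.
module Submission where

open import Defs
open import Data.Nat using (ℕ; suc; _<_; s<s⁻¹)
open import Data.Nat.Properties using (<-cmp)
open import Relation.Binary.Definitions using (tri<; tri≈; tri>)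
open import Data.List using (List; []; _∷_; map)
open import Data.Maybe using (just; nothing)
open import Relation.Binary.PropositionalEquality using (_≡_; refl; cong)
open import Data.List.Relation.Unary.Linked as Linked using (Linked; []; [-]; _∷_)
import Data.List.Relation.Unary.Linked.Properties as Linked

Sorted : List ℕ → Set
Sorted = Linked _<_

data Merge : List ℕ → List ℕ → List ℕ → Set where
  []ˡ : ∀ {ℓ} → Merge [] ℓ ℓ
  []ʳ : ∀ {ℓ} → Merge ℓ [] ℓ
  <-step : ∀ {i₁ i₂ ℓ₁ ℓ₂ ℓ} → i₁ < i₂ → Merge ℓ₁ (i₂ ∷ ℓ₂) ℓ →
           Merge (i₁ ∷ ℓ₁) (i₂ ∷ ℓ₂) (i₁ ∷ ℓ)
  >-step : ∀ {i₁ i₂ ℓ₁ ℓ₂ ℓ} → i₂ < i₁ → Merge (i₁ ∷ ℓ₁) ℓ₂ ℓ →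
           Merge (i₁ ∷ ℓ₁) (i₂ ∷ ℓ₂) (i₂ ∷ ℓ)

mutual
  ‡⇒Merge : ∀ ℓ₁ ℓ₂ {ℓ} → ℓ₁ ‡ ℓ₂ ≡ just ℓ → Merge ℓ₁ ℓ₂ ℓ
  ‡⇒Merge []        ℓ₂ refl = []ˡ
  ‡⇒Merge (i₁ ∷ ℓ₁) ℓ₂ eq   = mergeAux⇒Merge i₁ ℓ₁ ℓ₂ eq

  mergeAux⇒Merge : ∀ i₁ ℓ₁ ℓ₂ {ℓ} → mergeAux i₁ ℓ₁ ℓ₂ ≡ just ℓ → Merge (i₁ ∷ ℓ₁) ℓ₂ ℓ
  mergeAux⇒Merge i₁ ℓ₁ []        refl = []ʳ
  mergeAux⇒Merge i₁ ℓ₁ (i₂ ∷ ℓ₂) eq with <-cmp i₁ i₂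
  mergeAux⇒Merge i₁ ℓ₁ (i₂ ∷ ℓ₂) ()  | tri≈ _ _ _
  mergeAux⇒Merge i₁ ℓ₁ (i₂ ∷ ℓ₂) eq  | tri< i₁<i₂ _ _
    with ℓ₁ ‡ (i₂ ∷ ℓ₂) in rest | eq
  ... | just ℓ | refl = <-step i₁<i₂ (‡⇒Merge ℓ₁ (i₂ ∷ ℓ₂) rest)
  ... | nothing | ()
  mergeAux⇒Merge i₁ ℓ₁ (i₂ ∷ ℓ₂) eq  | tri> _ _ i₂<i₁
    with mergeAux i₁ ℓ₁ ℓ₂ in rest | eq
  ... | just ℓ | refl = >-step i₂<i₁ (mergeAux⇒Merge i₁ ℓ₁ ℓ₂ rest)
  ... | nothing | ()

Merge-sorted-above : ∀ {x ℓ₁ ℓ₂ ℓ} → Sorted (x ∷ ℓ₁) → Sorted (x ∷ ℓ₂) →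
                     Merge ℓ₁ ℓ₂ ℓ → Sorted (x ∷ ℓ)
Merge-sorted-above _ s₂ []ˡ = s₂
Merge-sorted-above s₁ _ []ʳ = s₁
Merge-sorted-above (x<i₁ ∷ s₁) (_ ∷ s₂) (<-step i₁<i₂ m) =
  x<i₁ ∷ Merge-sorted-above s₁ (i₁<i₂ ∷ s₂) m
Merge-sorted-above (_ ∷ s₁) (x<i₂ ∷ s₂) (>-step i₂<i₁ m) =
  x<i₂ ∷ Merge-sorted-above (i₂<i₁ ∷ s₁) s₂ m

Merge-sorted : ∀ {ℓ₁ ℓ₂ ℓ} → Sorted ℓ₁ → Sorted ℓ₂ → Merge ℓ₁ ℓ₂ ℓ → Sorted ℓ
Merge-sorted _  s₂ []ˡ                = s₂
Merge-sorted s₁ _  []ʳ                = s₁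
Merge-sorted s₁ s₂ (<-step i₁<i₂ m) = Merge-sorted-above s₁ (i₁<i₂ ∷ s₂) m
Merge-sorted s₁ s₂ (>-step i₂<i₁ m) = Merge-sorted-above (i₂<i₁ ∷ s₁) s₂ m

‡-sorted : ∀ {ℓ₁ ℓ₂ ℓ} → Sorted ℓ₁ → Sorted ℓ₂ → ℓ₁ ‡ ℓ₂ ≡ just ℓ → Sorted ℓ
‡-sorted {ℓ₁} {ℓ₂} s₁ s₂ eq = Merge-sorted s₁ s₂ (‡⇒Merge ℓ₁ ℓ₂ eq)

↓⇒map-suc : ∀ ℓ {ℓ'} → ↓ ℓ ≡ just ℓ' → ℓ ≡ map suc ℓ'
↓⇒map-suc []          refl = refl
↓⇒map-suc (0 ∷ ℓ)     ()
↓⇒map-suc (suc i ∷ ℓ) eq with ↓ ℓ in rest | eq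
... | just ℓ' | refl = cong (suc i ∷_) (↓⇒map-suc ℓ rest)
... | nothing | ()

map-suc-sorted⁻ : ∀ {ℓ} → Sorted (map suc ℓ) → Sorted ℓ
map-suc-sorted⁻ s = Linked.map s<s⁻¹ (Linked.map⁻ s)

↓-sorted : ∀ {ℓ ℓ'} → Sorted ℓ → ↓ ℓ ≡ just ℓ' → Sorted ℓ'
↓-sorted {ℓ} s eq rewrite ↓⇒map-suc ℓ eq = map-suc-sorted⁻ s

proposition1 : (t : Term) (ℓ : List ℕ) → t ∶ ℓ → Linked _<_ ℓ
proposition1 _ _ (ind i)             = [-]
proposition1 _ _ (abs {t} {ℓ} d eq) = ↓-sorted (Linked.tail (proposition1 t (0 ∷ ℓ) d)) eq
proposition1 _ _ (ap {t₁} {t₂} {ℓ₁} {ℓ₂} d₁ d₂ eq) =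
  ‡-sorted (proposition1 t₁ ℓ₁ d₁) (proposition1 t₂ ℓ₂ d₂) eq
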